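{- For every complexity measure $\psi$ and every table $T\in\mathcal{M}_k^2$, $M_\psi(T)\le 2\hat S_\psi(T)$.
   Context: Fix an integer $k\ge 2$; $E_k=\{0,\ldots,k-1\}$, $E_2=\{0,1\}$, $\omega=\{0,1,2,\ldots\}$, $P=\{f_i:i\in\omega\}$ a set of attribute names. $\mathcal{M}_k^2$ is the set of rectangular tables filled with numbers from $E_k$, columns labeled with pairwise different attributes from $P$, rows pairwise different, each row labeled with a decision from $E_2$; the table without rows is denoted $\Lambda$. $P(T)$ is the set of column attributes. $\mathcal{M}_k^2\mathcal{C}$ is the set of tables in which all rows have the same decision ($\Lambda$ included). $T(f_{i_1},\delta_1)\cdots(f_{i_m},\delta_m)$ is the table of rows of $T$ having values $\delta_1,\ldots,\delta_m$ in the columns labeled $f_{i_1},\ldots,f_{i_m}$. Operations: for $D\subseteq P(T)$, $I(D,T)$ deletes the columns labeled by $D$ and, in each group of rows coinciding on the remaining columns, keeps one row with the minimum decision; $I(P(T),T)=\Lambda$. For $\nu:E_k^{|P(T)|}\to E_2$, $J(\nu,T)$ replaces the decision of each row $\bar\delta$ by $\nu(\bar\delta)$. $[T]=\{J(\nu,I(D,T)):D\subseteq P(T),\nu:E_k^{|P(T)\setminus D|}\to E_2\}$. Let $B$ be the set of finite words over $P$ (with empty word $\lambda$). A complexity measure is $\psi:B\to\omega$ with $\psi(\alpha)=0$ iff $\alpha=\lambda$, invariant under permutation of letters, $\psi(\alpha_1)\le\psi(\alpha_1\alpha_2)\le\psi(\alpha_1)+\psi(\alpha_2)$. For finite $D\subseteq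 P$: $\psi(\emptyset)=0$, $\psi(\{f_{i_1},\ldots,f_{i_m}\})=\psi(f_{i_1}\cdots f_{i_m})$. Parameters ($0$ on $\Lambda$); for $T\ne\Lambda$: for a row $\bar\delta$ of $T$, $S_\psi(T,\bar\delta)$ is the minimum of $\psi(D)$ over $D\subseteq P(T)$ such that on the columns labeled by $D$ the row $\bar\delta$ differs from all other rows of $T$; $S_\psi(T)=\max_{\bar\delta}S_\psi(T,\bar\delta)$; $\hat S_\psi(T)=\max\{S_\psi(T^*):T^*\in[T]\}$. $M_\psi(T)=0$ if $T\in\mathcal{M}_k^2\mathcal{C}$; otherwise, with columns of $T$ labeled $f_{t_1},\ldots,f_{t_n}$, for $\bar\delta=(\delta_1,\ldots,\delta_n)\in E_k^n$ let $M_\psi(T,\bar\delta)$ be the minimum $p\in\omega$ such that there exist attributes $f_{t_{i_1}},\ldots,f_{t_{i_m}}\in P(T)$ with $T(f_{t_{i_1}},\delta_{i_1})\cdots(f_{t_{i_m}},\delta_{i_m})\in\mathcal{M}_k^2\mathcal{C}$ and $\psi(f_{t_{i_1}}\cdots f_{t_{i_m}})=p$; and $M_\psi(T)=\max\{M_\psi(T,\bar\delta):\bar\delta\in E_k^n\}$. -}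

module Defs where

open import Data.Nat using (ℕ; zero; suc; _+_; _≤_; _⊓_; _⊔_)
open import Data.Bool using (Bool; true; false; _∧_; _∨_; not; if_then_else_)
open import Data.Fin using (Fin; zero; suc)
import Data.Fin.Properties as FinP
open import Data.Vec using (Vec; []; _∷_; lookup)
import Data.Vec.Properties as VecP
open import Data.List using (List; []; _∷_; _++_; map; concatMap; allFin; foldr)
open import Data.List.Relation.Unary.Unique.Propositional using (Unique)
open import Data.List.Relation.Binary.Permutation.Propositional using (_↭_)
open import Data.Product using (_×_; _,_; proj₁; proj₂)
open import Relation.Binary.PropositionalEquality using (_≡_)
open import Relation.Nullary.Decidable using (⌊_⌋)

-- Attributes f_i are represented by their index i : ℕ.
-- Words over P (the set B) are lists of attribute indices.

record ComplexityMeasure : Set where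
  field
    ψ        : List ℕ → ℕ
    zero⇒λ   : ∀ α → ψ α ≡ 0 → α ≡ []
    λ⇒zero   : ψ [] ≡ 0
    perm     : ∀ {α β} → α ↭ β → ψ α ≡ ψ β
    mono     : ∀ α β → ψ α ≤ ψ (α ++ β)
    subadd   : ∀ α β → ψ (α ++ β) ≤ ψ α + ψ β

open ComplexityMeasure public

-- Decisions E₂ = Fin 2, values E_k = Fin k.

Dec2 : Set
Dec2 = Fin 2

min2 : Dec2 → Dec2 → Dec2
min2 zero _ = zero
min2 (suc _) d = d

record Table (k : ℕ) : Set where
  constructor mkTable
  field
    n    : ℕ
    cols : Vec ℕ n
    rows : List (Vec (Fin k) n × Dec2)

open Table public

-- Membership in 𝓜_k^2: column labels pairwise different, rows pairwise different.
record WellFormed {k : ℕ} (T : Table k) : Set where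
  field
    colsDistinct : ∀ i j → lookup (cols T) i ≡ lookup (cols T) j → i ≡ j
    rowsDistinct : Unique (map proj₁ (rows T))

Subset : ℕ → Set
Subset n = Vec Bool n

subsets : ∀ n → List (Subset n)
subsets zero = [] ∷ []
subsets (suc n) = concatMap (λ s → (true ∷ s) ∷ (false ∷ s) ∷ []) (subsets n)

allVecs : ∀ k n → List (Vec (Fin k) n)
allVecs k zero = [] ∷ []
allVecs k (suc n) = concatMap (λ x → map (x ∷_) (allVecs k n)) (allFin k)

allFinFuns : ∀ {A : Set} k → List A → List (Fin k → A)
allFinFuns zero as = (λ ()) ∷ []
allFinFuns (suc k) as =
  concatMap (λ a → map (λ g → λ { zero → a ; (suc i) → g i }) (allFinFuns k as)) as

allν : ∀ k m → List (Vec (Fin k) m → Dec2)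
allν k zero = map (λ b → λ _ → b) (zero ∷ suc zero ∷ [])
allν k (suc m) = map (λ F → λ { (x ∷ xs) → F x xs }) (allFinFuns k (allν k m))

all : ∀ {A : Set} → (A → Bool) → List A → Bool
all p [] = true
all p (x ∷ xs) = p x ∧ all p xs

-- minimum of a list (0 on the empty list; only used on nonempty lists)
minList : List ℕ → ℕ
minList [] = 0
minList (x ∷ xs) = foldr _⊓_ x xs

maxList : List ℕ → ℕ
maxList = foldr _⊔_ 0

select : ∀ {A : Set} {n} → Subset n → Vec A n → List A
select [] [] = []
select (true ∷ D) (x ∷ xs) = x ∷ select D xs
select (false ∷ D) (x ∷ xs) = select D xs

ψset : ∀ {k} → ComplexityMeasure → (T : Table k) → Subset (n T) → ℕ
ψset Ψ T D = ψ Ψ (select D (cols T))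

agreeOn : ∀ {k n} → Subset n → Vec (Fin k) n → Vec (Fin k) n → Bool
agreeOn [] [] [] = true
agreeOn (true ∷ D) (x ∷ xs) (y ∷ ys) = ⌊ x FinP.≟ y ⌋ ∧ agreeOn D xs ys
agreeOn (false ∷ D) (x ∷ xs) (y ∷ ys) = agreeOn D xs ys

eqRow : ∀ {k n} → Vec (Fin k) n → Vec (Fin k) n → Bool
eqRow u v = ⌊ VecP.≡-dec FinP._≟_ u v ⌋

-- 𝓜_k^2 𝓒 : all rows have the same decision (Λ included)

isConstDec : List Dec2 → Bool
isConstDec [] = true
isConstDec (d ∷ ds) = all (λ e → ⌊ e FinP.≟ d ⌋) ds

InC : ∀ {k} → Table k → Bool
InC T = isConstDec (map proj₂ (rows T))

subTable : ∀ {k} (T : Table k) → Subset (n T) → Vec (Fin k) (n T) → Table k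
subTable T D δ = mkTable (n T) (cols T) (Data.List.filterᵇ (λ r → agreeOn D δ (proj₁ r)) (rows T))

keepLen : ∀ {n} → Subset n → ℕ
keepLen [] = 0
keepLen (true ∷ D) = keepLen D
keepLen (false ∷ D) = suc (keepLen D)

dropCols : ∀ {A : Set} {n} (D : Subset n) → Vec A n → Vec A (keepLen D)
dropCols [] [] = []
dropCols (true ∷ D) (x ∷ xs) = dropCols D xs
dropCols (false ∷ D) (x ∷ xs) = x ∷ dropCols D xs

insertRow : ∀ {k m} → Vec (Fin k) m × Dec2 → List (Vec (Fin k) m × Dec2) → List (Vec (Fin k) m × Dec2)
insertRow r [] = r ∷ []
insertRow (v , d) ((w , e) ∷ acc) =
  if eqRow v w then (w , min2 e d) ∷ acc else (w , e) ∷ insertRow (v , d) acc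

I : ∀ {k} (T : Table k) → Subset (n T) → Table k
I T D with keepLen D
... | zero = mkTable 0 [] []                     -- I(P(T),T) = Λ
... | suc _ = mkTable (keepLen D) (dropCols D (cols T))
                 (foldr insertRow [] (map (λ r → dropCols D (proj₁ r) , proj₂ r) (rows T)))

J : ∀ {k} (T : Table k) → (Vec (Fin k) (n T) → Dec2) → Table k
J T ν = mkTable (n T) (cols T) (map (λ r → proj₁ r , ν (proj₁ r)) (rows T))

closure : ∀ {k} → Table k → List (Table k)
closure {k} T = concatMap (λ D → map (J (I T D)) (allν k (n (I T D)))) (subsets (n T))

Srow : ∀ {k} → ComplexityMeasure → (T : Table k) → Vec (Fin k) (n T) → ℕ
Srow Ψ T δ = minList (map (ψset Ψ T)
  (Data.List.filterᵇ (λ D → all (λ r → eqRow δ (proj₁ r) ∨ not (agreeOn D δ (proj₁ r))) (rows T))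
     (subsets (n T))))

S : ∀ {k} → ComplexityMeasure → Table k → ℕ
S Ψ T = maxList (map (λ r → Srow Ψ T (proj₁ r)) (rows T))

Ŝ : ∀ {k} → ComplexityMeasure → Table k → ℕ
Ŝ Ψ T = maxList (map (S Ψ) (closure T))

Mrow : ∀ {k} → ComplexityMeasure → (T : Table k) → Vec (Fin k) (n T) → ℕ
Mrow Ψ T δ = minList (map (ψset Ψ T)
  (Data.List.filterᵇ (λ D → InC (subTable T D δ)) (subsets (n T))))

M : ∀ {k} → ComplexityMeasure → Table k → ℕ
M {k} Ψ T = if InC T then 0 else maxList (map (Mrow Ψ T) (allVecs k (n T)))

-- Fix δ and let r be a row of T that agrees with δ in as many columns as possible; let Aᵣ be
-- the set of those columns. For any set K of columns, delete the columns outside K; relabelling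
-- the decisions does not change S, so the resulting table has S ≤ Ŝ(T), and separating the image
-- of r in it gives E ⊆ K with ψ(E) ≤ Ŝ(T) such that every row agreeing with r on E agrees with r
-- on all of K. Taking K = Aᵣ gives E₁. If all rows agree with r outside Aᵣ, the rows of T(E₁, δ) all equal r,
-- so this subtable is in 𝓜𝓒 and M(T, δ) ≤ Ŝ(T). Otherwise some row differs from r in a column
-- g ∉ Aᵣ; taking K = {g} gives E₂, which must contain g. A row agreeing with δ on E₁ ∪ E₂ would
-- then agree with δ on Aᵣ and at g, contradicting the choice of r, so T(E₁ ∪ E₂, δ) is empty,
-- and ψ(E₁ ∪ E₂) ≤ ψ(E₁) + ψ(E₂) ≤ 2 Ŝ(T).

module Submission where

open import Defs
open import Data.Nat using (ℕ; zero; suc; _+_; _*_; _≤_; z≤n)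
open import Data.Nat.Properties
  using (≤-refl; ≤-reflexive; ≤-trans; <⇒≱; ⊔-lub; ⊓-sel; m≤n⇒m≤n⊔o; m≤n⇒m≤o⊔n; m≤n⇒m⊓o≤n; m≤n⇒o⊓m≤n;
         +-mono-≤; +-identityʳ; m≤n*m; module ≤-Reasoning)
open import Data.Bool using (Bool; true; false; _∧_; _∨_; not)
import Data.Bool as Bool
open import Data.Bool.Properties using (T-∧)
open import Data.Fin using (Fin; zero; suc)
open import Data.Fin.Properties using (_≟_; any?)
open import Data.Fin.Subset using (_∪_; _∩_; ∁; _⊆_; _⊂_; ⊤; ⊥; ⁅_⁆; ∣_∣; Empty)
  renaming (_∈_ to _∈ₛ_; _∉_ to _∉ₛ_)
open import Data.Fin.Subset.Properties
  using (_∈?_; drop-∷-⊆; ⊆-min; x∈∁p⇒x∉p; x∉∁p⇒x∈p; x∉p⇒x∈∁p; x∈p⇒x∉∁p;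
         x∈⁅x⁆; x∈⁅y⁆⇒x≡y; p⊆p∪q; q⊆p∪q; p⊂q⇒∣p∣<∣q∣)
open import Data.Vec using (Vec; []; _∷_; lookup; here; there)
import Data.Vec.Properties as Vecₚ
open import Data.List using (List; []; _∷_; _++_; map; foldr; filterᵇ)
open import Data.List.Properties using (foldr-preservesᵇ; foldr-preservesᵒ; filter-≐; map-∘; map-cong)
open import Data.List.Membership.Propositional using (_∈_; lose; find)
open import Data.List.Membership.Propositional.Properties
  using (∈-map⁺; ∈-map⁻; ∈-filter⁺; ∈-filter⁻; ∈-concatMap⁺; foldr-selective)
open import Data.List.Relation.Unary.Any as Any using (Any; here; there)
open import Data.List.Relation.Unary.All as All using (All; []; _∷_)
import Data.List.Relation.Unary.All.Properties as All
open import Data.List.Relation.Unary.Unique.Propositional using (Unique)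
open import Data.List.Relation.Unary.AllPairs using (_∷_)
open import Data.List.Relation.Binary.Permutation.Propositional using (_↭_; prep; ↭-sym; ↭-trans; ↭-refl)
open import Data.List.Relation.Binary.Permutation.Propositional.Properties using (shift)
open import Data.List.Extrema.Nat using (argmax; argmax-sel; f[⊥]≤f[argmax]; f[xs]≤f[argmax])
open import Data.Product using (_×_; _,_; proj₁; proj₂; ∃; ∃-syntax)
open import Data.Sum using (_⊎_; inj₁; inj₂; [_,_]; [_,_]′)
open import Data.Unit using (tt)
open import Data.Empty using (⊥-elim)
open import Function using (_∘_; Equivalence)
open import Relation.Binary.PropositionalEquality using (_≡_; refl; sym; trans; cong; cong₂; subst)
open import Relation.Nullary using (¬_; yes; no; contradiction; ¬?; _×-dec_)
open import Relation.Nullary.Decidable using (⌊_⌋; toWitness; fromWitness)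

private
  variable
    A B : Set
    k m : ℕ

maxList-≥ : ∀ {x xs} → x ∈ xs → x ≤ maxList xs
maxList-≥ {xs = xs} x∈ =
  foldr-preservesᵒ (λ a b → [ m≤n⇒m≤n⊔o b , m≤n⇒m≤o⊔n a ]) 0 xs (inj₂ (Any.map ≤-reflexive x∈))

maxList-≤ : ∀ {b xs} → All (_≤ b) xs → maxList xs ≤ b
maxList-≤ = foldr-preservesᵇ ⊔-lub z≤n

minList-≤ : ∀ {x xs} → x ∈ xs → minList xs ≤ x
minList-≤ {xs = y ∷ ys} x∈ =
  foldr-preservesᵒ (λ a b → [ m≤n⇒m⊓o≤n b , m≤n⇒o⊓m≤n a ]) y ys (at x∈)
  where
  at : ∀ {x} → x ∈ y ∷ ys → y ≤ x ⊎ Any (_≤ x) ys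
  at (here refl) = inj₁ ≤-refl
  at (there x∈ys) = inj₂ (Any.map (≤-reflexive ∘ sym) x∈ys)

minList-∈ : ∀ {x xs} → x ∈ xs → minList xs ∈ xs
minList-∈ {xs = y ∷ ys} _ = [ here , there ]′ (foldr-selective ⊓-sel y ys)

∃-argmax : (f : A → ℕ) → ∀ {x xs} → x ∈ xs → ∃[ m ] m ∈ xs × All (λ y → f y ≤ f m) xs
∃-argmax f {xs = y ∷ ys} _ =
  argmax f y ys , [ here , there ]′ (argmax-sel f y ys) ,
  f[⊥]≤f[argmax] {f = f} y ys ∷ f[xs]≤f[argmax] {f = f} y ys

T-all⁻ : ∀ {p : A → Bool} xs → Bool.T (all p xs) → All (Bool.T ∘ p) xs
T-all⁻ [] _ = []
T-all⁻ (x ∷ xs) t = let px , pxs = Equivalence.to T-∧ t in px ∷ T-all⁻ xs pxs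

T-all⁺ : ∀ {p : A → Bool} {xs} → All (Bool.T ∘ p) xs → Bool.T (all p xs)
T-all⁺ [] = tt
T-all⁺ (px ∷ pxs) = Equivalence.from T-∧ (px , T-all⁺ pxs)

T-∨-not⁺ : ∀ {a b} → (Bool.T b → Bool.T a) → Bool.T (a ∨ not b)
T-∨-not⁺ {true} _ = tt
T-∨-not⁺ {false} {true} b⇒a = b⇒a tt
T-∨-not⁺ {false} {false} _ = tt

T-∨-not⁻ : ∀ {a b} → Bool.T (a ∨ not b) → Bool.T b → Bool.T a
T-∨-not⁻ {true} _ _ = tt
T-∨-not⁻ {false} {true} () _
T-∨-not⁻ {false} {false} _ ()

all-map : ∀ (p : B → Bool) (f : A → B) xs → all p (map f xs) ≡ all (p ∘ f) xs
all-map p f [] = refl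
all-map p f (x ∷ xs) = cong (p (f x) ∧_) (all-map p f xs)

filterᵇ-cong : ∀ {p q : A → Bool} → (∀ x → p x ≡ q x) → ∀ xs → filterᵇ p xs ≡ filterᵇ q xs
filterᵇ-cong p≗q = filter-≐ _ _ ((λ {x} → subst Bool.T (p≗q x)) , (λ {x} → subst Bool.T (sym (p≗q x))))

∈-unique-map : ∀ {f : A → B} {xs x y} → Unique (map f xs) → x ∈ xs → y ∈ xs → f x ≡ f y → x ≡ y
∈-unique-map _ (here refl) (here refl) _ = refl
∈-unique-map {f = f} (x≢ ∷ _) (here refl) (there y∈) fx≡fy =
  contradiction fx≡fy (All.lookup x≢ (∈-map⁺ f y∈))
∈-unique-map {f = f} (y≢ ∷ _) (there x∈) (here refl) fx≡fy =
  contradiction (sym fx≡fy) (All.lookup y≢ (∈-map⁺ f x∈))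
∈-unique-map (_ ∷ unique) (there x∈) (there y∈) fx≡fy = ∈-unique-map unique x∈ y∈ fx≡fy

∈-subsets : (E : Subset m) → E ∈ subsets m
∈-subsets [] = here refl
∈-subsets (true ∷ E) = ∈-concatMap⁺ _ (lose (∈-subsets E) (here refl))
∈-subsets (false ∷ E) = ∈-concatMap⁺ _ (lose (∈-subsets E) (there (here refl)))

allFinFuns-nonempty : ∀ k {as : List A} → ∃ (_∈ as) → ∃ (_∈ allFinFuns k as)
allFinFuns-nonempty zero _ = _ , here refl
allFinFuns-nonempty (suc k) (a , a∈) =
  let _ , g∈ = allFinFuns-nonempty k (a , a∈) in _ , ∈-concatMap⁺ _ (lose a∈ (∈-map⁺ _ g∈))

allν-nonempty : ∀ k m → ∃ (_∈ allν k m)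
allν-nonempty k zero = _ , here refl
allν-nonempty k (suc m) = let _ , F∈ = allFinFuns-nonempty k (allν-nonempty k m) in _ , ∈-map⁺ _ F∈

agreement : Vec (Fin k) m → Vec (Fin k) m → Subset m
agreement [] [] = []
agreement (x ∷ u) (y ∷ v) = ⌊ x ≟ y ⌋ ∷ agreement u v

∈-agreement⁺ : ∀ {u v : Vec (Fin k) m} {i} → lookup u i ≡ lookup v i → i ∈ₛ agreement u v
∈-agreement⁺ {u = x ∷ u} {y ∷ v} {zero} x≡y with x ≟ y
... | yes _ = here
... | no x≢y = contradiction x≡y x≢y
∈-agreement⁺ {u = x ∷ u} {y ∷ v} {suc i} u≡v = there (∈-agreement⁺ u≡v)

∈-agreement⁻ : ∀ {u v : Vec (Fin k) m} {i} → i ∈ₛ agreement u v → lookup u i ≡ lookup v i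
∈-agreement⁻ {u = x ∷ u} {y ∷ v} {zero} i∈ with x ≟ y
∈-agreement⁻ {u = x ∷ u} {y ∷ v} {zero} i∈ | yes x≡y = x≡y
∈-agreement⁻ {u = x ∷ u} {y ∷ v} {zero} () | no _
∈-agreement⁻ {u = x ∷ u} {y ∷ v} {suc i} (there i∈) = ∈-agreement⁻ i∈

agreeOn⇒⊆ : ∀ {E : Subset m} {u v : Vec (Fin k) m} → Bool.T (agreeOn E u v) → E ⊆ agreement u v
agreeOn⇒⊆ {E = true ∷ E} {x ∷ u} {y ∷ v} t here =
  ∈-agreement⁺ {i = zero} (toWitness {a? = x ≟ y} (proj₁ (Equivalence.to T-∧ t)))
agreeOn⇒⊆ {E = true ∷ E} {x ∷ u} {y ∷ v} t (there i∈) =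
  there (agreeOn⇒⊆ (proj₂ (Equivalence.to (T-∧ {⌊ x ≟ y ⌋}) t)) i∈)
agreeOn⇒⊆ {E = false ∷ E} {x ∷ u} {y ∷ v} t (there i∈) = there (agreeOn⇒⊆ t i∈)

⊆⇒agreeOn : ∀ {E : Subset m} {u v : Vec (Fin k) m} → E ⊆ agreement u v → Bool.T (agreeOn E u v)
⊆⇒agreeOn {E = []} {[]} {[]} _ = tt
⊆⇒agreeOn {E = true ∷ E} {x ∷ u} {y ∷ v} E⊆ =
  Equivalence.from T-∧ (fromWitness (∈-agreement⁻ {i = zero} (E⊆ here)) , ⊆⇒agreeOn (drop-∷-⊆ E⊆))
⊆⇒agreeOn {E = false ∷ E} {x ∷ u} {y ∷ v} E⊆ = ⊆⇒agreeOn (drop-∷-⊆ E⊆)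

⊤⊆agreement⇒≡ : ∀ {u v : Vec (Fin k) m} → ⊤ ⊆ agreement u v → u ≡ v
⊤⊆agreement⇒≡ {u = []} {[]} _ = refl
⊤⊆agreement⇒≡ {u = x ∷ u} {y ∷ v} ⊤⊆ =
  cong₂ _∷_ (∈-agreement⁻ {i = zero} (⊤⊆ here)) (⊤⊆agreement⇒≡ (drop-∷-⊆ ⊤⊆))

eqRow⇒≡ : ∀ {u v : Vec (Fin k) m} → Bool.T (eqRow u v) → u ≡ v
eqRow⇒≡ {u = u} {v} = toWitness {a? = Vecₚ.≡-dec _≟_ u v}

≡⇒eqRow : ∀ {u v : Vec (Fin k) m} → u ≡ v → Bool.T (eqRow u v)
≡⇒eqRow {u = u} {v} = fromWitness {a? = Vecₚ.≡-dec _≟_ u v}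

select-⊥ : (xs : Vec A m) → select ⊥ xs ≡ []
select-⊥ [] = refl
select-⊥ (x ∷ xs) = select-⊥ xs

select-∪-∩ : (p q : Subset m) (xs : Vec A m) →
             select (p ∪ q) xs ++ select (p ∩ q) xs ↭ select p xs ++ select q xs
select-∪-∩ [] [] [] = ↭-refl
select-∪-∩ (true ∷ p) (true ∷ q) (x ∷ xs) =
  prep x (↭-trans (shift x (select (p ∪ q) xs) _)
                  (↭-trans (prep x (select-∪-∩ p q xs)) (↭-sym (shift x (select p xs) _))))
select-∪-∩ (true ∷ p) (false ∷ q) (x ∷ xs) = prep x (select-∪-∩ p q xs)
select-∪-∩ (false ∷ p) (true ∷ q) (x ∷ xs) =
  ↭-trans (prep x (select-∪-∩ p q xs)) (↭-sym (shift x (select p xs) _))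
select-∪-∩ (false ∷ p) (false ∷ q) (x ∷ xs) = select-∪-∩ p q xs

ψ-select-∪ : ∀ (Ψ : ComplexityMeasure) (p q : Subset m) (xs : Vec ℕ m) →
             ψ Ψ (select (p ∪ q) xs) ≤ ψ Ψ (select p xs) + ψ Ψ (select q xs)
ψ-select-∪ Ψ p q xs = begin
  ψ Ψ (select (p ∪ q) xs)                         ≤⟨ mono Ψ _ (select (p ∩ q) xs) ⟩
  ψ Ψ (select (p ∪ q) xs ++ select (p ∩ q) xs)    ≡⟨ perm Ψ (select-∪-∩ p q xs) ⟩
  ψ Ψ (select p xs ++ select q xs)                ≤⟨ subadd Ψ _ _ ⟩
  ψ Ψ (select p xs) + ψ Ψ (select q xs)           ∎
  where open ≤-Reasoning

Separates : (X : Table k) → Vec (Fin k) (n X) → Subset (n X) → Set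
Separates X v E = ∀ {w} → w ∈ map proj₁ (rows X) → E ⊆ agreement v w → v ≡ w

isSeparating : (X : Table k) → Vec (Fin k) (n X) → Subset (n X) → Bool
isSeparating X v E = all (λ q → eqRow v (proj₁ q) ∨ not (agreeOn E v (proj₁ q))) (rows X)

isSeparating⇒Separates : ∀ (X : Table k) {v E} → Bool.T (isSeparating X v E) → Separates X v E
isSeparating⇒Separates X sep w∈ E⊆ with ∈-map⁻ proj₁ w∈
... | q , q∈ , refl = eqRow⇒≡ (T-∨-not⁻ (All.lookup (T-all⁻ (rows X) sep) q∈) (⊆⇒agreeOn E⊆))

⊤-isSeparating : ∀ (X : Table k) v → Bool.T (isSeparating X v ⊤)
⊤-isSeparating X v = T-all⁺ (All.universal
  (λ q → T-∨-not⁺ (≡⇒eqRow ∘ ⊤⊆agreement⇒≡ ∘ agreeOn⇒⊆ {u = v} {proj₁ q})) (rows X))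

Srow-attained : ∀ Ψ (X : Table k) v → ∃[ E ] Separates X v E × ψset Ψ X E ≡ Srow Ψ X v
Srow-attained Ψ X v =
  let E , E∈ , Srow≡ψE = ∈-map⁻ (ψset Ψ X) (minList-∈ (∈-map⁺ (ψset Ψ X) ⊤∈separating))
      _ , E-separating = ∈-filter⁻ (Bool.T? ∘ isSeparating X v) {xs = subsets (n X)} E∈
  in E , isSeparating⇒Separates X E-separating , sym Srow≡ψE
  where
  ⊤∈separating : ⊤ ∈ filterᵇ (isSeparating X v) (subsets (n X))
  ⊤∈separating = ∈-filter⁺ (Bool.T? ∘ isSeparating X v) (∈-subsets ⊤) (⊤-isSeparating X v)

Srow≤S : ∀ Ψ (X : Table k) {v} → v ∈ map proj₁ (rows X) → Srow Ψ X v ≤ S Ψ X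
Srow≤S Ψ X v∈ with ∈-map⁻ proj₁ v∈
... | q , q∈ , refl = maxList-≥ (∈-map⁺ (λ r → Srow Ψ X (proj₁ r)) q∈)

isSeparating-J : ∀ (X : Table k) ν v E → isSeparating (J X ν) v E ≡ isSeparating X v E
isSeparating-J X ν v E =
  all-map (λ q → eqRow v (proj₁ q) ∨ not (agreeOn E v (proj₁ q))) (λ q → proj₁ q , ν (proj₁ q)) (rows X)

Srow-J : ∀ Ψ (X : Table k) ν v → Srow Ψ (J X ν) v ≡ Srow Ψ X v
Srow-J Ψ X ν v = cong (minList ∘ map (ψset Ψ X)) (filterᵇ-cong (isSeparating-J X ν v) (subsets (n X)))

S-J : ∀ Ψ (X : Table k) ν → S Ψ (J X ν) ≡ S Ψ X
S-J Ψ X ν =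
  cong maxList (trans (sym (map-∘ (rows X))) (map-cong (λ r → Srow-J Ψ X ν (proj₁ r)) (rows X)))

S-I≤Ŝ : ∀ Ψ (T : Table k) D → S Ψ (I T D) ≤ Ŝ Ψ T
S-I≤Ŝ {k} Ψ T D with allν-nonempty k (n (I T D))
... | ν , ν∈ = subst (_≤ Ŝ Ψ T) (S-J Ψ (I T D) ν) (maxList-≥ (∈-map⁺ (S Ψ) J∈closure))
  where
  J∈closure : J (I T D) ν ∈ closure T
  J∈closure = ∈-concatMap⁺ _ (lose (∈-subsets D) (∈-map⁺ (J (I T D)) ν∈))

embed : (D : Subset m) → Subset (keepLen D) → Subset m
embed [] E = []
embed (true ∷ D) E = false ∷ embed D E
embed (false ∷ D) (b ∷ E) = b ∷ embed D E

select-embed : ∀ (D : Subset m) E (xs : Vec A m) → select (embed D E) xs ≡ select E (dropCols D xs)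
select-embed [] [] [] = refl
select-embed (true ∷ D) E (x ∷ xs) = select-embed D E xs
select-embed (false ∷ D) (true ∷ E) (x ∷ xs) = cong (x ∷_) (select-embed D E xs)
select-embed (false ∷ D) (false ∷ E) (x ∷ xs) = select-embed D E xs

agreeOn-embed : ∀ (D : Subset m) E (u v : Vec (Fin k) m) →
                agreeOn (embed D E) u v ≡ agreeOn E (dropCols D u) (dropCols D v)
agreeOn-embed [] [] [] [] = refl
agreeOn-embed (true ∷ D) E (x ∷ u) (y ∷ v) = agreeOn-embed D E u v
agreeOn-embed (false ∷ D) (true ∷ E) (x ∷ u) (y ∷ v) = cong (⌊ x ≟ y ⌋ ∧_) (agreeOn-embed D E u v)
agreeOn-embed (false ∷ D) (false ∷ E) (x ∷ u) (y ∷ v) = agreeOn-embed D E u v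

embed⊆∁ : ∀ (D : Subset m) {E} → embed D E ⊆ ∁ D
embed⊆∁ (true ∷ D) (there i∈) = there (embed⊆∁ D i∈)
embed⊆∁ (false ∷ D) {b ∷ E} here = here
embed⊆∁ (false ∷ D) {b ∷ E} (there i∈) = there (embed⊆∁ D i∈)

dropCols-≡⇒∁⊆agreement : ∀ (D : Subset m) {u v : Vec (Fin k) m} →
                         dropCols D u ≡ dropCols D v → ∁ D ⊆ agreement u v
dropCols-≡⇒∁⊆agreement (true ∷ D) {_ ∷ _} {_ ∷ _} u≡v (there i∈) =
  there (dropCols-≡⇒∁⊆agreement D u≡v i∈)
dropCols-≡⇒∁⊆agreement (false ∷ D) {_ ∷ _} {_ ∷ _} u≡v here =
  ∈-agreement⁺ {i = zero} (Vecₚ.∷-injectiveˡ u≡v)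
dropCols-≡⇒∁⊆agreement (false ∷ D) {_ ∷ _} {_ ∷ _} u≡v (there i∈) =
  there (dropCols-≡⇒∁⊆agreement D (Vecₚ.∷-injectiveʳ u≡v) i∈)

keepLen≡0⇒Empty∁ : (D : Subset m) → keepLen D ≡ 0 → Empty (∁ D)
keepLen≡0⇒Empty∁ (true ∷ D) kept≡0 (suc i , there i∈) = keepLen≡0⇒Empty∁ D kept≡0 (i , i∈)

insertRow-keeps : ∀ (r : Vec (Fin k) m × Dec2) acc {w} →
                  w ∈ map proj₁ (r ∷ acc) → w ∈ map proj₁ (insertRow r acc)
insertRow-keeps r [] w∈ = w∈
insertRow-keeps (v , d) ((v′ , e) ∷ acc) w∈ with Vecₚ.≡-dec _≟_ v v′ | w∈
... | yes v≡v′ | here w≡v = here (trans w≡v v≡v′)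
... | yes _ | there w∈′ = w∈′
... | no _ | here w≡v = there (insertRow-keeps (v , d) acc (here w≡v))
... | no _ | there (here w≡v′) = here w≡v′
... | no _ | there (there w∈acc) = there (insertRow-keeps (v , d) acc (there w∈acc))

foldr-insertRow-keeps : ∀ (rs : List (Vec (Fin k) m × Dec2)) {w} →
                        w ∈ map proj₁ rs → w ∈ map proj₁ (foldr insertRow [] rs)
foldr-insertRow-keeps (r ∷ rs) (here w≡) = insertRow-keeps r (foldr insertRow [] rs) (here w≡)
foldr-insertRow-keeps (r ∷ rs) (there w∈) =
  insertRow-keeps r (foldr insertRow [] rs) (there (foldr-insertRow-keeps rs w∈))

-- I T D is project T D unless every column is deleted.
project : (T : Table k) → Subset (n T) → Table k
project T D = mkTable (keepLen D) (dropCols D (cols T))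
                      (foldr insertRow [] (map (λ r → dropCols D (proj₁ r) , proj₂ r) (rows T)))

Determines : (T : Table k) → Vec (Fin k) (n T) → Subset (n T) → Subset (n T) → Set
Determines T v E K = ∀ {s} → s ∈ rows T → E ⊆ agreement v (proj₁ s) → K ⊆ agreement v (proj₁ s)

-- Pull back along embed a minimal separating set of the image of r in project T D.
project-determining-set : ∀ Ψ (T : Table k) D {r} → r ∈ rows T →
  ∃[ E ] E ⊆ ∁ D × ψset Ψ T E ≤ S Ψ (project T D) × Determines T (proj₁ r) E (∁ D)
project-determining-set Ψ T D {r} r∈ with Srow-attained Ψ (project T D) (dropCols D (proj₁ r))
... | E , E-separates , ψE≡Srow = embed D E , embed⊆∁ D , ψE≤S , determines
  where
  row-of-project : ∀ {s} → s ∈ rows T → dropCols D (proj₁ s) ∈ map proj₁ (rows (project T D))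
  row-of-project s∈ = foldr-insertRow-keeps _ (∈-map⁺ proj₁ (∈-map⁺ _ s∈))

  ψE≤S : ψset Ψ T (embed D E) ≤ S Ψ (project T D)
  ψE≤S = begin
    ψ Ψ (select (embed D E) (cols T))             ≡⟨ cong (ψ Ψ) (select-embed D E (cols T)) ⟩
    ψset Ψ (project T D) E                        ≡⟨ ψE≡Srow ⟩
    Srow Ψ (project T D) (dropCols D (proj₁ r))   ≤⟨ Srow≤S Ψ (project T D) (row-of-project r∈) ⟩
    S Ψ (project T D)                             ∎
    where open ≤-Reasoning

  determines : Determines T (proj₁ r) (embed D E) (∁ D)
  determines s∈ E⊆ = dropCols-≡⇒∁⊆agreement D (E-separates (row-of-project s∈)
    (agreeOn⇒⊆ (subst Bool.T (agreeOn-embed D E (proj₁ r) _) (⊆⇒agreeOn E⊆))))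

I-determining-set : ∀ Ψ (T : Table k) D {r} → r ∈ rows T →
  ∃[ E ] E ⊆ ∁ D × ψset Ψ T E ≤ S Ψ (I T D) × Determines T (proj₁ r) E (∁ D)
I-determining-set Ψ T D r∈ with keepLen D in no-column-kept
... | zero =
  ⊥ , ⊆-min _ , ≤-reflexive ψ⊥≡0 , λ _ _ i∈ → ⊥-elim (keepLen≡0⇒Empty∁ D no-column-kept (_ , i∈))
  where
  ψ⊥≡0 : ψset Ψ T ⊥ ≡ 0
  ψ⊥≡0 = trans (cong (ψ Ψ) (select-⊥ (cols T))) (λ⇒zero Ψ)
... | suc _ = project-determining-set Ψ T D r∈

determining-set : ∀ Ψ (T : Table k) K {r} → r ∈ rows T →
  ∃[ E ] E ⊆ K × ψset Ψ T E ≤ Ŝ Ψ T × Determines T (proj₁ r) E K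
determining-set Ψ T K r∈ =
  let E , E⊆∁∁K , ψE≤ , determines = I-determining-set Ψ T (∁ K) r∈
  in E , x∉∁p⇒x∈p ∘ x∈∁p⇒x∉p ∘ E⊆∁∁K , ≤-trans ψE≤ (S-I≤Ŝ Ψ T (∁ K)) ,
     λ s∈ E⊆ → determines s∈ E⊆ ∘ x∉p⇒x∈∁p ∘ x∈p⇒x∉∁p

isConstDec-intro : ∀ {ds c} → All (_≡ c) ds → Bool.T (isConstDec ds)
isConstDec-intro [] = tt
isConstDec-intro (d≡c ∷ ds≡c) = T-all⁺ (All.map (λ e≡c → fromWitness (trans e≡c (sym d≡c))) ds≡c)

Mrow≤ψset : ∀ Ψ (T : Table k) δ D {c} →
  (∀ {s} → s ∈ rows T → D ⊆ agreement δ (proj₁ s) → proj₂ s ≡ c) → Mrow Ψ T δ ≤ ψset Ψ T D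
Mrow≤ψset Ψ T δ D decided = minList-≤ (∈-map⁺ (ψset Ψ T) (∈-filter⁺ _ (∈-subsets D) subTable-constant))
  where
  subTable-constant : Bool.T (InC (subTable T D δ))
  subTable-constant = isConstDec-intro (All.map⁺ (All.tabulate λ s∈ →
    let s∈T , agrees = ∈-filter⁻ _ {xs = rows T} s∈ in decided s∈T (agreeOn⇒⊆ agrees)))

⊆∧∁⊆⇒⊤⊆ : ∀ {p q : Subset m} → p ⊆ q → ∁ p ⊆ q → ⊤ ⊆ q
⊆∧∁⊆⇒⊤⊆ {p = p} p⊆q ∁p⊆q {i} _ with i ∈? p
... | yes i∈p = p⊆q i∈p
... | no i∉p = ∁p⊆q (x∉p⇒x∈∁p i∉p)

module _ {k} (Ψ : ComplexityMeasure) (T : Table k) (wf : WellFormed T) (δ : Vec (Fin k) (n T))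
         {r} (r∈ : r ∈ rows T)
         (closest : All (λ s → ∣ agreement (proj₁ s) δ ∣ ≤ ∣ agreement (proj₁ r) δ ∣) (rows T)) where

  private
    Aᵣ : Subset (n T)
    Aᵣ = agreement (proj₁ r) δ

    via-δ : ∀ {E w} → E ⊆ Aᵣ → E ⊆ agreement δ w → E ⊆ agreement (proj₁ r) w
    via-δ E⊆Aᵣ E⊆ i∈ = ∈-agreement⁺ (trans (∈-agreement⁻ (E⊆Aᵣ i∈)) (∈-agreement⁻ (E⊆ i∈)))

  Mrow≤Ŝ-if-rows-agree-off-Aᵣ : (∀ {s} → s ∈ rows T → ∁ Aᵣ ⊆ agreement (proj₁ r) (proj₁ s)) →
                               Mrow Ψ T δ ≤ Ŝ Ψ T
  Mrow≤Ŝ-if-rows-agree-off-Aᵣ agree-off-Aᵣ with determining-set Ψ T Aᵣ r∈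
  ... | E , E⊆Aᵣ , ψE≤ , determines = ≤-trans (Mrow≤ψset Ψ T δ E decision-of-r) ψE≤
    where
    decision-of-r : ∀ {s} → s ∈ rows T → E ⊆ agreement δ (proj₁ s) → proj₂ s ≡ proj₂ r
    decision-of-r s∈ E⊆ = cong proj₂ (∈-unique-map (WellFormed.rowsDistinct wf) s∈ r∈
      (sym (⊤⊆agreement⇒≡ (⊆∧∁⊆⇒⊤⊆ (determines s∈ (via-δ E⊆Aᵣ E⊆)) (agree-off-Aᵣ s∈)))))

  Mrow≤2Ŝ-if-row-differs-off-Aᵣ : ∀ {g s₀} → g ∉ₛ Aᵣ → s₀ ∈ rows T →
                                  g ∉ₛ agreement (proj₁ r) (proj₁ s₀) → Mrow Ψ T δ ≤ 2 * Ŝ Ψ T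
  Mrow≤2Ŝ-if-row-differs-off-Aᵣ {g} {s₀} g∉Aᵣ s₀∈ g∉s₀
    with determining-set Ψ T Aᵣ r∈ | determining-set Ψ T ⁅ g ⁆ r∈
  ... | E₁ , E₁⊆Aᵣ , ψE₁≤ , determines₁ | E₂ , E₂⊆g , ψE₂≤ , determines₂ = begin
    Mrow Ψ T δ                  ≤⟨ Mrow≤ψset Ψ T δ (E₁ ∪ E₂) {proj₂ r} (λ s∈ → ⊥-elim ∘ no-row-agrees s∈) ⟩
    ψset Ψ T (E₁ ∪ E₂)          ≤⟨ ψ-select-∪ Ψ E₁ E₂ (cols T) ⟩
    ψset Ψ T E₁ + ψset Ψ T E₂   ≤⟨ +-mono-≤ ψE₁≤ ψE₂≤ ⟩
    Ŝ Ψ T + Ŝ Ψ T               ≡⟨ cong (Ŝ Ψ T +_) (sym (+-identityʳ (Ŝ Ψ T))) ⟩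
    2 * Ŝ Ψ T                   ∎
    where
    open ≤-Reasoning

    g∈E₂ : g ∈ₛ E₂
    g∈E₂ with g ∈? E₂
    ... | yes g∈ = g∈
    ... | no g∉ = contradiction (determines₂ s₀∈ vacuous (x∈⁅x⁆ g)) g∉s₀
      where
      vacuous : E₂ ⊆ agreement (proj₁ r) (proj₁ s₀)
      vacuous i∈ = contradiction (subst (_∈ₛ E₂) (x∈⁅y⁆⇒x≡y g (E₂⊆g i∈)) i∈) g∉

    no-row-agrees : ∀ {s} → s ∈ rows T → ¬ (E₁ ∪ E₂ ⊆ agreement δ (proj₁ s))
    no-row-agrees {s} s∈ E⊆ = <⇒≱ (p⊂q⇒∣p∣<∣q∣ Aᵣ⊂) (All.lookup closest s∈)
      where
      Aᵣ⊆ : Aᵣ ⊆ agreement (proj₁ r) (proj₁ s)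
      Aᵣ⊆ = determines₁ s∈ (via-δ E₁⊆Aᵣ (E⊆ ∘ p⊆p∪q E₂))

      Aᵣ⊂ : Aᵣ ⊂ agreement (proj₁ s) δ
      Aᵣ⊂ = (λ i∈ → ∈-agreement⁺ (trans (sym (∈-agreement⁻ (Aᵣ⊆ i∈))) (∈-agreement⁻ i∈))) ,
            g , ∈-agreement⁺ (sym (∈-agreement⁻ (E⊆ (q⊆p∪q E₁ E₂ g∈E₂)))) , g∉Aᵣ

  Mrow≤2Ŝ-at-closest : Mrow Ψ T δ ≤ 2 * Ŝ Ψ T
  Mrow≤2Ŝ-at-closest
    with any? (λ g → ¬? (g ∈? Aᵣ) ×-dec Any.any? (λ s → ¬? (g ∈? agreement (proj₁ r) (proj₁ s))) (rows T))
  ... | yes (g , g∉Aᵣ , differs) =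
    let s₀ , s₀∈ , g∉s₀ = find differs in Mrow≤2Ŝ-if-row-differs-off-Aᵣ g∉Aᵣ s₀∈ g∉s₀
  ... | no none = ≤-trans (Mrow≤Ŝ-if-rows-agree-off-Aᵣ agree-off-Aᵣ) (m≤n*m (Ŝ Ψ T) 2)
    where
    agree-off-Aᵣ : ∀ {s} → s ∈ rows T → ∁ Aᵣ ⊆ agreement (proj₁ r) (proj₁ s)
    agree-off-Aᵣ {s} s∈ {g} g∈∁Aᵣ with g ∈? agreement (proj₁ r) (proj₁ s)
    ... | yes g∈ = g∈
    ... | no g∉ = contradiction (g , x∈∁p⇒x∉p g∈∁Aᵣ , lose s∈ g∉) none

Mrow≤2Ŝ : ∀ Ψ (T : Table k) → WellFormed T → ∀ {r₀} → r₀ ∈ rows T → ∀ δ → Mrow Ψ T δ ≤ 2 * Ŝ Ψ T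
Mrow≤2Ŝ Ψ T wf r₀∈ δ =
  let _ , r∈ , closest = ∃-argmax (λ s → ∣ agreement (proj₁ s) δ ∣) r₀∈
  in Mrow≤2Ŝ-at-closest Ψ T wf δ r∈ closest

M≤ : ∀ Ψ (T : Table k) {b} → (∀ δ → Mrow Ψ T δ ≤ b) → M Ψ T ≤ b
M≤ {k} Ψ T Mrow≤b with InC T
... | true = z≤n
... | false = maxList-≤ (All.map⁺ (All.universal Mrow≤b (allVecs k (n T))))

-- The bound holds for every k.
lemma7 : (k : ℕ) → 2 ≤ k → (Ψ : ComplexityMeasure) → (T : Table k) → WellFormed T →
         M Ψ T ≤ 2 * Ŝ Ψ T
lemma7 k _ Ψ (mkTable _ _ []) _ = z≤n
lemma7 k _ Ψ T@(mkTable _ _ (_ ∷ _)) wf = M≤ Ψ T (Mrow≤2Ŝ Ψ T wf (here refl))
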